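{- Let $m_2>m_1\ge1$ be integers. Consider tilings with $(\frac12,\frac12;m_1)$-combs and $(\frac12,\frac12;m_2)$-combs. For every mixed metatile of length $l$, the arrangement obtained by interchanging the contents of the left and right slots in each cell is again a mixed metatile of length $l$, and it is distinct from the original one. Hence the mixed metatiles occur in pairs, one member of each pair being obtained from the other by this interchange.
   Context: For a positive integer $k$, a $(\frac12,\frac12;k)$-comb is a tile consisting of $k$ teeth of size $\frac12\times1$ in a row separated by $k-1$ gaps of width $\frac12$ (a $(\frac12,\frac12;1)$-comb is a half-square). An $n$-board is a $1\times n$ strip of $n$ unit cells, each divided into a left and a right slot of width $\frac12$. A tiling of an $n$-board places combs so that each tooth occupies exactly one slot and every slot is occupied by exactly one tooth (gaps of a comb may contain teeth of other combs). A tile straddles the boundary between cells $i$ and $i+1$ if the interval from the left end of its first tooth to the right end of its last tooth contains that boundary in its interior. A metatile of length $l$ is a tiling of an $l$-board in which every one of the $l-1$ internal cell boundaries is straddled by some tile (i.e. it cannot be split into tilings of smaller blocks of consecutive cells). A mixed metatile is a metatile that contains combs of both types. -}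

module Defs where

open import Data.Nat using (ℕ; zero; suc; _+_; _*_; _<_; _≤_)
open import Data.Fin using (Fin; toℕ)
open import Data.Vec using (Vec; lookup; map)
open import Data.Maybe using (Maybe; just; nothing)
open import Data.Product using (_×_; ∃-syntax; proj₁; proj₂; swap)
open import Data.Sum using (_⊎_)
open import Relation.Binary.PropositionalEquality using (_≡_)

-- A cell of the board has a left slot and a right slot.  We record, for each
-- slot, whether the FIRST (leftmost) tooth of some comb lies in that slot, and
-- if so the number k of teeth of that comb:  just k  = "a (1/2,1/2;k)-comb
-- starts here",  nothing  = "no comb starts here".
-- Since two combs can never start in the same slot (it would be covered
-- twice), a tiling (a set of placed combs) is exactly such a marker board.
Cell : Set
Cell = Maybe ℕ × Maybe ℕ

-- an l-board with comb placements; cells 0 .. l-1 from left to right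
Board : ℕ → Set
Board l = Vec Cell l

-- the marker in slot d (0 = left, 1 = right) of cell i
startAt : ∀ {l} → Board l → Fin l → Fin 2 → Maybe ℕ
startAt B i Fin.zero = proj₁ (lookup B i)
startAt B i (Fin.suc Fin.zero) = proj₂ (lookup B i)

-- global slot index: slots 0 .. 2l-1 from left to right; slot s is the
-- interval [s/2, (s+1)/2] in cell units
pos : ∀ {l} → Fin l → Fin 2 → ℕ
pos i d = 2 * toℕ i + toℕ d

-- a k-comb whose first tooth is in slot s has its teeth in slots s + 2t, t < k
Covers : ℕ → ℕ → ℕ → Set
Covers s k j = ∃[ t ] (t < k × j ≡ s + 2 * t)

IsTiling : ℕ → ℕ → (l : ℕ) → Board l → Set
IsTiling m₁ m₂ l B =
  (∀ i d k → startAt B i d ≡ just k →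
      (k ≡ m₁ ⊎ k ≡ m₂) × (∀ t → t < k → pos i d + 2 * t < 2 * l))
  × (∀ (i : Fin l) (d : Fin 2) → ∃[ i' ] ∃[ d' ] ∃[ k ]
        (startAt B i' d' ≡ just k × Covers (pos i' d') k (pos i d)))
  × (∀ (i i₁ i₂ : Fin l) (d d₁ d₂ : Fin 2) (k₁ k₂ : ℕ) →
        startAt B i₁ d₁ ≡ just k₁ → Covers (pos i₁ d₁) k₁ (pos i d) →
        startAt B i₂ d₂ ≡ just k₂ → Covers (pos i₂ d₂) k₂ (pos i d) →
        (i₁ ≡ i₂ × d₁ ≡ d₂))

-- a k-comb starting in slot s occupies the interval [s/2, (s + 2(k-1) + 1)/2];
-- it straddles the cell boundary at position b (between cells b-1 and b,
-- 0-indexed) iff  s/2 < b < (s + 2k - 1)/2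
Straddles : ℕ → ℕ → ℕ → Set
Straddles s k b = s < 2 * b × 2 * b + 1 < s + 2 * k

IsMetatile : ℕ → ℕ → (l : ℕ) → Board l → Set
IsMetatile m₁ m₂ l B =
  IsTiling m₁ m₂ l B
  × (∀ b → 1 ≤ b → b < l → ∃[ i ] ∃[ d ] ∃[ k ]
        (startAt B i d ≡ just k × Straddles (pos i d) k b))

IsMixed : ∀ {l} → ℕ → ℕ → Board l → Set
IsMixed m₁ m₂ B =
  (∃[ i ] ∃[ d ] (startAt B i d ≡ just m₁)) × (∃[ i ] ∃[ d ] (startAt B i d ≡ just m₂))

IsMixedMetatile : ℕ → ℕ → (l : ℕ) → Board l → Set
IsMixedMetatile m₁ m₂ l B = IsMetatile m₁ m₂ l B × IsMixed m₁ m₂ B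

-- interchange the contents of the left and right slots of every cell
-- (a tooth in slot s+2t moves to (s xor 1)+2t, so a comb starting in the
-- left/right slot of a cell now starts in the right/left slot of that cell)
interchange : ∀ {l} → Board l → Board l
interchange B = map swap B

-- Interchanging the two slots of every cell maps each comb to a comb of the same length starting
-- in the same cell, so tilings, straddled boundaries and the comb types present are all preserved.
-- If the interchange fixed a metatile, every cell holding a comb start would hold two starts of
-- the same length in its two slots; a comb straddling the boundary in front of such a cell would
-- then cover it in the slot of its own first tooth, where one of those two combs also starts.
-- As every internal boundary of a metatile is straddled, all combs start in the first cell, whose
-- two slots then carry the same comb type.
module Submission where

open import Defs
open import Data.Nat using (ℕ; _≤_; _<_)
open import Data.Product using (_×_)
open import Relation.Binary.PropositionalEquality using (_≡_; _≢_)

open import Data.Nat using (suc; _+_; _*_; _∸_; s≤s⁻¹)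
open import Data.Nat.Properties
open import Data.Nat.Tactic.RingSolver using (solve-∀)
open import Data.Fin using (Fin; toℕ; opposite)
import Data.Fin as Fin
open import Data.Fin.Properties using (toℕ<n; toℕ-injective; opposite-involutive)
open import Data.Vec.Properties using (lookup-map; map-∘; map-id)
open import Data.Maybe using (just)
open import Data.Maybe.Properties using (just-injective)
open import Data.Product using (_,_; proj₁; proj₂; swap; ∃-syntax)
open import Data.Sum using (_⊎_; inj₁; inj₂)
open import Function using (_∘_)
open import Relation.Nullary using (¬_; contradiction)
open import Relation.Binary.PropositionalEquality using (refl; sym; trans; cong; cong₂; subst; module ≡-Reasoning)

opposite-injective : ∀ {n} {d e : Fin n} → opposite d ≡ opposite e → d ≡ e
opposite-injective {d = d} {e} eq =
  trans (sym (opposite-involutive d)) (trans (cong opposite eq) (opposite-involutive e))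

slot : ℕ → Fin 2 → ℕ
slot a d = 2 * a + toℕ d

slot-+-double : ∀ a d t → slot a d + 2 * t ≡ slot (a + t) d
slot-+-double a d t = shift a (toℕ d) t
  where
  shift : ∀ a d t → 2 * a + d + 2 * t ≡ 2 * (a + t) + d
  shift = solve-∀

slot-injective : ∀ a c d e → slot a d ≡ slot c e → a ≡ c × d ≡ e
slot-injective a c Fin.zero Fin.zero eq =
  *-cancelˡ-≡ a c 2 (+-cancelʳ-≡ 0 (2 * a) (2 * c) eq) , refl
slot-injective a c Fin.zero (Fin.suc Fin.zero) eq =
  contradiction (trans (sym (+-identityʳ (2 * a))) (trans eq (+-comm (2 * c) 1))) (even≢odd a c)
slot-injective a c (Fin.suc Fin.zero) Fin.zero eq =
  contradiction (trans (sym (+-identityʳ (2 * c))) (trans (sym eq) (+-comm (2 * a) 1))) (even≢odd c a)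
slot-injective a c (Fin.suc Fin.zero) (Fin.suc Fin.zero) eq =
  *-cancelˡ-≡ a c 2 (+-cancelʳ-≡ 1 (2 * a) (2 * c) eq) , refl

slot<double-suc : ∀ a d → slot a d < 2 * suc a
slot<double-suc a d = begin-strict
  2 * a + toℕ d ≤⟨ +-monoʳ-≤ (2 * a) (s≤s⁻¹ (toℕ<n d)) ⟩
  2 * a + 1     <⟨ +-monoʳ-< (2 * a) (n<1+n 1) ⟩
  2 * a + 2     ≡⟨ +-comm (2 * a) 2 ⟩
  2 + 2 * a     ≡⟨ *-suc 2 a ⟨
  2 * suc a     ∎
  where open ≤-Reasoning

slot<double⇒< : ∀ a b d → slot a d < 2 * b → a < b
slot<double⇒< a b d lt = *-cancelˡ-< 2 a b (≤-<-trans (m≤m+n (2 * a) (toℕ d)) lt)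

<⇒slot<double : ∀ a b d → a < b → slot a d < 2 * b
<⇒slot<double a b d a<b = <-≤-trans (slot<double-suc a d) (*-monoʳ-≤ 2 a<b)

double+1<slot⇒< : ∀ a b d → 2 * b + 1 < slot a d → b < a
double+1<slot⇒< a b d lt =
  *-cancelˡ-< 2 b a (+-cancelʳ-< 1 (2 * b) (2 * a) (<-≤-trans lt (+-monoʳ-≤ (2 * a) (s≤s⁻¹ (toℕ<n d)))))

<⇒double+1<slot : ∀ a b d → b < a → 2 * b + 1 < slot a d
<⇒double+1<slot a b d b<a =
  <-≤-trans (slot<double-suc b (Fin.suc Fin.zero)) (≤-trans (*-monoʳ-≤ 2 b<a) (m≤m+n (2 * a) (toℕ d)))

straddles⇒between : ∀ a k b d → Straddles (slot a d) k b → a < b × b < a + k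
straddles⇒between a k b d (starts-before , ends-after) =
  slot<double⇒< a b d starts-before ,
  double+1<slot⇒< (a + k) b d (subst (2 * b + 1 <_) (slot-+-double a d k) ends-after)

between⇒straddles : ∀ a k b d → a < b × b < a + k → Straddles (slot a d) k b
between⇒straddles a k b d (a<b , b<a+k) =
  <⇒slot<double a b d a<b ,
  subst (2 * b + 1 <_) (sym (slot-+-double a d k)) (<⇒double+1<slot (a + k) b d b<a+k)

straddles-slot-irrelevant : ∀ a k b d e → Straddles (slot a d) k b → Straddles (slot a e) k b
straddles-slot-irrelevant a k b d e = between⇒straddles a k b e ∘ straddles⇒between a k b d

tooth<board-slot-irrelevant : ∀ a t l d e → slot a d + 2 * t < 2 * l → slot a e + 2 * t < 2 * l
tooth<board-slot-irrelevant a t l d e lt =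
  subst (_< 2 * l) (sym (slot-+-double a e t))
    (<⇒slot<double (a + t) l e (slot<double⇒< (a + t) l d (subst (_< 2 * l) (slot-+-double a d t) lt)))

covers-relabel : ∀ a c k d e d′ e′ → (e ≡ d → e′ ≡ d′) →
  Covers (slot a d) k (slot c e) → Covers (slot a d′) k (slot c e′)
covers-relabel a c k d e d′ e′ relabel (t , t<k , eq)
  with slot-injective c (a + t) e d (trans eq (slot-+-double a d t))
... | c≡a+t , e≡d = t , t<k , (begin
  slot c e′         ≡⟨ cong₂ slot c≡a+t (relabel e≡d) ⟩
  slot (a + t) d′   ≡⟨ slot-+-double a d′ t ⟨
  slot a d′ + 2 * t ∎)
  where open ≡-Reasoning

between⇒covers : ∀ a c k d → a ≤ c → c < a + k → Covers (slot a d) k (slot c d)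
between⇒covers a c k d a≤c c<a+k =
  c ∸ a ,
  +-cancelˡ-< a (c ∸ a) k (subst (_< a + k) (sym (m+[n∸m]≡n a≤c)) c<a+k) ,
  sym (trans (slot-+-double a d (c ∸ a)) (cong (λ x → slot x d) (m+[n∸m]≡n a≤c)))

startAt-interchange : ∀ {l} (B : Board l) i d → startAt (interchange B) i d ≡ startAt B i (opposite d)
startAt-interchange B i Fin.zero rewrite lookup-map i swap B = refl
startAt-interchange B i (Fin.suc Fin.zero) rewrite lookup-map i swap B = refl

startAt-interchange-opposite : ∀ {l} (B : Board l) i d → startAt (interchange B) i (opposite d) ≡ startAt B i d
startAt-interchange-opposite B i d =
  trans (startAt-interchange B i (opposite d)) (cong (startAt B i) (opposite-involutive d))

interchange-involutive : ∀ {l} (B : Board l) → interchange (interchange B) ≡ B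
interchange-involutive B = trans (sym (map-∘ swap swap B)) (map-id B)

module _ (m₁ m₂ : ℕ) {l : ℕ} (B : Board l) where

  interchange-preserves-tiling : IsTiling m₁ m₂ l B → IsTiling m₁ m₂ l (interchange B)
  interchange-preserves-tiling (combs-fit , slots-covered , covered-once) = fit , covered , once
    where
    B′ = interchange B

    fit : ∀ i d k → startAt B′ i d ≡ just k →
      (k ≡ m₁ ⊎ k ≡ m₂) × (∀ t → t < k → pos i d + 2 * t < 2 * l)
    fit i d k h with combs-fit i (opposite d) k (trans (sym (startAt-interchange B i d)) h)
    ... | type , inside =
      type , λ t t<k → tooth<board-slot-irrelevant (toℕ i) t l (opposite d) d (inside t t<k)

    covered : ∀ i d → ∃[ i′ ] ∃[ d′ ] ∃[ k ] (startAt B′ i′ d′ ≡ just k × Covers (pos i′ d′) k (pos i d))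
    covered i d with slots-covered i (opposite d)
    ... | i′ , d′ , k , h , cov =
      i′ , opposite d′ , k , trans (startAt-interchange-opposite B i′ d′) h ,
      covers-relabel (toℕ i′) (toℕ i) k d′ (opposite d) (opposite d′) d
        (λ eq → trans (sym (opposite-involutive d)) (cong opposite eq)) cov

    once : ∀ i i₁ i₂ d d₁ d₂ k₁ k₂ →
      startAt B′ i₁ d₁ ≡ just k₁ → Covers (pos i₁ d₁) k₁ (pos i d) →
      startAt B′ i₂ d₂ ≡ just k₂ → Covers (pos i₂ d₂) k₂ (pos i d) →
      i₁ ≡ i₂ × d₁ ≡ d₂
    once i i₁ i₂ d d₁ d₂ k₁ k₂ h₁ c₁ h₂ c₂
      with covered-once i i₁ i₂ (opposite d) (opposite d₁) (opposite d₂) k₁ k₂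
             (trans (sym (startAt-interchange B i₁ d₁)) h₁)
             (covers-relabel (toℕ i₁) (toℕ i) k₁ d₁ d (opposite d₁) (opposite d) (cong opposite) c₁)
             (trans (sym (startAt-interchange B i₂ d₂)) h₂)
             (covers-relabel (toℕ i₂) (toℕ i) k₂ d₂ d (opposite d₂) (opposite d) (cong opposite) c₂)
    ... | i₁≡i₂ , d₁≡d₂ = i₁≡i₂ , opposite-injective d₁≡d₂

  interchange-preserves-metatile : IsMetatile m₁ m₂ l B → IsMetatile m₁ m₂ l (interchange B)
  interchange-preserves-metatile (tiling , straddled) = interchange-preserves-tiling tiling , straddled′
    where
    straddled′ : ∀ b → 1 ≤ b → b < l → ∃[ i ] ∃[ d ] ∃[ k ]
      (startAt (interchange B) i d ≡ just k × Straddles (pos i d) k b)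
    straddled′ b 1≤b b<l with straddled b 1≤b b<l
    ... | i , d , k , h , s =
      i , opposite d , k , trans (startAt-interchange-opposite B i d) h ,
      straddles-slot-irrelevant (toℕ i) k b d (opposite d) s

  interchange-preserves-mixed : IsMixed m₁ m₂ B → IsMixed m₁ m₂ (interchange B)
  interchange-preserves-mixed ((i₁ , d₁ , h₁) , (i₂ , d₂ , h₂)) =
    (i₁ , opposite d₁ , trans (startAt-interchange-opposite B i₁ d₁) h₁) ,
    (i₂ , opposite d₂ , trans (startAt-interchange-opposite B i₂ d₂) h₂)

startAt-slot-irrelevant : ∀ {l} {B : Board l} → interchange B ≡ B → ∀ i d e → startAt B i d ≡ startAt B i e
startAt-slot-irrelevant {B = B} fixed i = irrelevant
  where
  to-opposite : ∀ d → startAt B i d ≡ startAt B i (opposite d)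
  to-opposite d = trans (cong (λ B′ → startAt B′ i d) (sym fixed)) (startAt-interchange B i d)

  irrelevant : ∀ d e → startAt B i d ≡ startAt B i e
  irrelevant Fin.zero Fin.zero = refl
  irrelevant Fin.zero (Fin.suc Fin.zero) = to-opposite Fin.zero
  irrelevant (Fin.suc Fin.zero) Fin.zero = to-opposite (Fin.suc Fin.zero)
  irrelevant (Fin.suc Fin.zero) (Fin.suc Fin.zero) = refl

module _ {m₁ m₂ : ℕ} (0<m₁ : 0 < m₁) (0<m₂ : 0 < m₂) {l : ℕ} {B : Board l} where

  comb-length-positive : IsTiling m₁ m₂ l B → ∀ {i d k} → startAt B i d ≡ just k → 0 < k
  comb-length-positive (combs-fit , _) {i} {d} {k} h with proj₁ (combs-fit i d k h)
  ... | inj₁ refl = 0<m₁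
  ... | inj₂ refl = 0<m₂

  symmetric-tiling-start-unstraddled : IsTiling m₁ m₂ l B → interchange B ≡ B →
    ∀ i d k j e k′ → startAt B i d ≡ just k → startAt B j e ≡ just k′ →
    ¬ Straddles (pos i d) k (toℕ j)
  symmetric-tiling-start-unstraddled tiling@(_ , _ , covered-once) fixed i d k j e k′ h hj s =
    <-irrefl (cong toℕ (proj₁ (covered-once j i j d d d k k′ h cov-i h′ cov-j))) i<j
    where
    h′ : startAt B j d ≡ just k′
    h′ = trans (startAt-slot-irrelevant fixed j d e) hj
    between : toℕ i < toℕ j × toℕ j < toℕ i + k
    between = straddles⇒between (toℕ i) k (toℕ j) d s
    i<j = proj₁ between
    cov-i : Covers (pos i d) k (pos j d)
    cov-i = between⇒covers (toℕ i) (toℕ j) k d (<⇒≤ i<j) (proj₂ between)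
    cov-j : Covers (pos j d) k′ (pos j d)
    cov-j = 0 , comb-length-positive tiling {j} {d} h′ , sym (+-identityʳ (pos j d))

  symmetric-metatile-starts-in-first-cell : IsMetatile m₁ m₂ l B → interchange B ≡ B →
    ∀ j e k′ → startAt B j e ≡ just k′ → toℕ j ≡ 0
  symmetric-metatile-starts-in-first-cell (tiling , straddled) fixed j e k′ hj =
    n<1⇒n≡0 (≰⇒> λ 1≤j → unstraddled (straddled (toℕ j) 1≤j (toℕ<n j)))
    where
    unstraddled : ¬ (∃[ i ] ∃[ d ] ∃[ k ] (startAt B i d ≡ just k × Straddles (pos i d) k (toℕ j)))
    unstraddled (i , d , k , h , s) = symmetric-tiling-start-unstraddled tiling fixed i d k j e k′ h hj s

  mixed-metatile-not-symmetric : m₁ ≢ m₂ → IsMixedMetatile m₁ m₂ l B → interchange B ≢ B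
  mixed-metatile-not-symmetric m₁≢m₂ (metatile , (i₁ , d₁ , h₁) , (i₂ , d₂ , h₂)) fixed =
    m₁≢m₂ (just-injective (begin
      just m₁        ≡⟨ h₁ ⟨
      startAt B i₁ d₁ ≡⟨ startAt-slot-irrelevant fixed i₁ d₁ d₂ ⟩
      startAt B i₁ d₂ ≡⟨ cong (λ i → startAt B i d₂) i₁≡i₂ ⟩
      startAt B i₂ d₂ ≡⟨ h₂ ⟩
      just m₂        ∎))
    where
    open ≡-Reasoning
    first-cell = symmetric-metatile-starts-in-first-cell metatile fixed
    i₁≡i₂ : i₁ ≡ i₂
    i₁≡i₂ = toℕ-injective (trans (first-cell i₁ d₁ m₁ h₁) (sym (first-cell i₂ d₂ m₂ h₂)))

lemma1 : (m₁ m₂ : ℕ) → 1 ≤ m₁ → m₁ < m₂ →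
    (l : ℕ) (B : Board l) → IsMixedMetatile m₁ m₂ l B →
    IsMixedMetatile m₁ m₂ l (interchange B)
    × interchange B ≢ B
    × interchange (interchange B) ≡ B
lemma1 m₁ m₂ 1≤m₁ m₁<m₂ l B mixed-metatile@(metatile , mixed) =
  (interchange-preserves-metatile m₁ m₂ B metatile , interchange-preserves-mixed m₁ m₂ B mixed) ,
  mixed-metatile-not-symmetric 1≤m₁ (<-trans 1≤m₁ m₁<m₂) (<⇒≢ m₁<m₂) mixed-metatile ,
  interchange-involutive B
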